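{- Let $v=2n$ be a positive integer and let $L$ be a list of $n$ positive integers not exceeding $n$. If there exists a perfect matching $F$ of $K_v$ such that $\ell(F)=L$, then for every divisor $d$ of $v$ such that $d$ does not divide $n$, the number of multiples of $d$ appearing in $L$ (counted with multiplicity) does not exceed $\frac{v-d}{2}$.
   Context: For a positive integer $v$, $K_v$ denotes the complete graph on the vertex set $\{0,1,\ldots,v-1\}$. The length of an edge $\{u,w\}$ of $K_v$ is $\ell(u,w)=\min(|u-w|,\,v-|u-w|)$. For a subgraph $\Gamma$ of $K_v$, $\ell(\Gamma)$ is the list (multiset) of lengths of all edges of $\Gamma$, counted with multiplicity. A perfect matching of $K_{2n}$ is a set of $n$ pairwise disjoint edges covering all vertices. -}

module Defs where

open import Data.Nat using (ℕ; _+_; _∸_; _⊓_; _≤_)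
open import Data.Nat.Divisibility using (_∣_; _∣?_)
open import Data.Fin using (Fin; toℕ)
open import Data.Product using (_×_; _,_; proj₁; proj₂)
open import Data.List using (List; []; _∷_; map; length; filter; concatMap)
open import Data.List.Relation.Unary.All using (All)
open import Data.List.Relation.Unary.Unique.Propositional using (Unique)
open import Data.List.Relation.Binary.Permutation.Propositional using (_↭_)
open import Relation.Binary.PropositionalEquality using (_≡_)
open import Relation.Nullary using (¬_)

Edge : ℕ → Set
Edge v = Fin v × Fin v

absDiff : ℕ → ℕ → ℕ
absDiff a b = (a ∸ b) + (b ∸ a)

edgeLength : (v : ℕ) → Edge v → ℕ
edgeLength v (u , w) = absDiff (toℕ u) (toℕ w) ⊓ (v ∸ absDiff (toℕ u) (toℕ w))

endpoints : {v : ℕ} → List (Edge v) → List (Fin v)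
endpoints = concatMap (λ e → proj₁ e ∷ proj₂ e ∷ [])

-- A perfect matching of K_{2n}: n edges, pairwise disjoint (all 2n endpoints
-- distinct, which also forces u ≠ w in each edge), hence covering all 2n vertices.
IsPerfectMatching : (n : ℕ) → List (Edge (n + n)) → Set
IsPerfectMatching n F = length F ≡ n × Unique (endpoints F)

lengths : {v : ℕ} → List (Edge v) → List ℕ
lengths {v} F = map (edgeLength v) F

countMultiples : ℕ → List ℕ → ℕ
countMultiples d L = length (filter (d ∣?_) L)

-- Since d divides 2n but not n, the cofactor 2n / d is odd, say 2j + 1, so every residue
-- class modulo d contains exactly 2j + 1 vertices. An edge whose length is a multiple of d
-- joins two vertices of the same class, and disjoint such edges cover an even number of its
-- vertices, so at most j of them lie in each class. Summing over the d classes bounds their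
-- number by dj = (2n - d)/2.
module Submission where

open import Defs
open import Data.Nat using (ℕ; _+_; _∸_; _≤_; _<_; _*_)
open import Data.Nat.Divisibility using (_∣_)
open import Data.Product using (Σ; _×_)
open import Data.List using (List; length)
open import Data.List.Relation.Unary.All using (All)
open import Data.List.Relation.Binary.Permutation.Propositional using (_↭_)
open import Relation.Nullary using (¬_)
open import Relation.Binary.PropositionalEquality using (_≡_)

open import Function using (_∘_; id)
open import Data.Nat using (zero; suc; z≤n; s≤s; s≤s⁻¹; NonZero; _/_; _%_; _≟_)
open import Data.Nat.Properties
open import Data.Nat.Divisibility using (divides; _∣?_; ∣m+n∣m⇒∣n; 0∣⇒≡0)
open import Data.Nat.DivMod using (m≡m%n+[m/n]*n; [m+kn]%n≡m%n; m<n*o⇒m/o<n; m%n<n)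
open import Data.Fin using (Fin; toℕ; fromℕ<)
open import Data.Fin.Properties using (toℕ-injective; toℕ<n; fromℕ<-injective; pigeonhole)
  renaming (<⇒≢ to <⇒≢ᶠ)
open import Data.Product using (∃-syntax; _,_; proj₁; proj₂)
open import Data.Sum using (inj₁; inj₂)
open import Data.List using ([]; _∷_; map; filter; lookup)
open import Data.List.Relation.Unary.All using ([]; _∷_)
import Data.List.Relation.Unary.All as All
import Data.List.Relation.Unary.All.Properties as All
open import Data.List.Properties using (length-map)
open import Data.List.Membership.Propositional using (_∈_)
open import Data.List.Membership.Propositional.Properties using (∈-lookup)
open import Data.List.Relation.Unary.Unique.Propositional using (Unique)
open import Data.List.Relation.Unary.AllPairs using ([]; _∷_)
import Data.List.Relation.Unary.Unique.Propositional.Properties as Unique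
open import Data.List.Relation.Binary.Sublist.Propositional using (_⊆_; _⊇_; []; _∷_; _∷ʳ_; ⊆-trans)
open import Data.List.Relation.Binary.Sublist.Propositional.Properties
  using (All-resp-⊆; filter-⊆; filter⁺; length-mono-≤)
open import Data.List.Relation.Binary.Permutation.Propositional using (↭-sym)
open import Data.List.Relation.Binary.Permutation.Propositional.Properties using (↭-length; filter-↭)
open import Relation.Binary.Definitions using (_Respects_)
open import Relation.Binary.PropositionalEquality using (refl; sym; trans; cong; cong₂; subst; module ≡-Reasoning)
open import Relation.Nullary using (yes; no; contradiction)
open import Relation.Unary using (Pred; Decidable)
open import Relation.Unary.Properties using (∁?)

module _ {A : Set} where

  length-filter+length-filter-∁ : ∀ {ℓ} {P : Pred A ℓ} (P? : Decidable P) (xs : List A) →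
    length (filter P? xs) + length (filter (∁? P?) xs) ≡ length xs
  length-filter+length-filter-∁ P? [] = refl
  length-filter+length-filter-∁ P? (x ∷ xs) with P? x
  ... | yes _ = cong suc (length-filter+length-filter-∁ P? xs)
  ... | no _ = trans (+-suc _ _) (cong suc (length-filter+length-filter-∁ P? xs))

  length-filter-map : ∀ {ℓ} {B : Set} {P : Pred B ℓ} (P? : Decidable P) (f : A → B) (xs : List A) →
    length (filter P? (map f xs)) ≡ length (filter (P? ∘ f) xs)
  length-filter-map P? f [] = refl
  length-filter-map P? f (x ∷ xs) with P? (f x)
  ... | yes _ = cong suc (length-filter-map P? f xs)
  ... | no _ = length-filter-map P? f xs

  Unique-resp-⊆ : Unique {A = A} Respects _⊇_
  Unique-resp-⊆ [] [] = []
  Unique-resp-⊆ (_ ∷ʳ xs⊆ys) (_ ∷ u) = Unique-resp-⊆ xs⊆ys u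
  Unique-resp-⊆ (refl ∷ xs⊆ys) (x∉ys ∷ u) = All-resp-⊆ xs⊆ys x∉ys ∷ Unique-resp-⊆ xs⊆ys u

  lookup-injective : {xs : List A} → Unique xs → {i j : Fin (length xs)} →
    lookup xs i ≡ lookup xs j → i ≡ j
  lookup-injective (_ ∷ _) {Fin.zero} {Fin.zero} _ = refl
  lookup-injective (x∉xs ∷ _) {Fin.zero} {Fin.suc j} x≡xs[j] =
    contradiction x≡xs[j] (All.lookup x∉xs (∈-lookup j))
  lookup-injective (x∉xs ∷ _) {Fin.suc i} {Fin.zero} xs[i]≡x =
    contradiction (sym xs[i]≡x) (All.lookup x∉xs (∈-lookup i))
  lookup-injective (_ ∷ u) {Fin.suc i} {Fin.suc j} eq = cong Fin.suc (lookup-injective u eq)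

  length≤-pigeonhole : (f : A → ℕ) {m : ℕ} {xs : List A} → Unique xs →
    (∀ {x y} → x ∈ xs → y ∈ xs → f x ≡ f y → x ≡ y) → All (λ x → f x < m) xs →
    length xs ≤ m
  length≤-pigeonhole f {xs = xs} u f-inj f<m = ≮⇒≥ λ m<length →
    let i , j , i<j , code≡ = pigeonhole m<length code
    in <⇒≢ᶠ i<j (lookup-injective u (f-inj (∈-lookup i) (∈-lookup j) (fromℕ<-injective _ _ _ _ code≡)))
    where
    code : Fin (length xs) → Fin _
    code i = fromℕ< (All.lookup f<m (∈-lookup i))

  length≤*-fibres : (f : A → ℕ) (m j : ℕ) (xs : List A) → All (λ x → f x < m) xs →
    (∀ r → length (filter (λ x → f x ≟ r) xs) ≤ j) → length xs ≤ m * j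
  length≤*-fibres f zero j [] _ _ = z≤n
  length≤*-fibres f zero j (_ ∷ _) (() ∷ _) _
  length≤*-fibres f (suc m) j xs f<1+m fibres≤j = begin
    length xs                                    ≡⟨ length-filter+length-filter-∁ (fibre? m) xs ⟨
    length (filter (fibre? m) xs) + length rest  ≤⟨ +-mono-≤ (fibres≤j m) rest≤m*j ⟩
    j + m * j                                    ∎
    where
    open ≤-Reasoning
    fibre? : (r : ℕ) → Decidable (λ x → f x ≡ r)
    fibre? r x = f x ≟ r
    rest : List A
    rest = filter (∁? (fibre? m)) xs
    rest<m : All (λ x → f x < m) rest
    rest<m = All.zipWith (λ (lt , ne) → ≤∧≢⇒< (s≤s⁻¹ lt) ne)
      (All.filter⁺ (∁? (fibre? m)) f<1+m , All.all-filter (∁? (fibre? m)) xs)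
    rest-fibres≤j : ∀ r → length (filter (fibre? r) rest) ≤ j
    rest-fibres≤j r = ≤-trans
      (length-mono-≤ (filter⁺ (fibre? r) (fibre? r) (λ { refl → id }) (filter-⊆ _ xs)))
      (fibres≤j r)
    rest≤m*j : length rest ≤ m * j
    rest≤m*j = length≤*-fibres f m j rest rest<m rest-fibres≤j

absDiff-comm : ∀ a b → absDiff a b ≡ absDiff b a
absDiff-comm a b = +-comm (a ∸ b) (b ∸ a)

absDiff≡∸ : ∀ {a b} → a ≤ b → absDiff a b ≡ b ∸ a
absDiff≡∸ {a} {b} a≤b = cong (_+ (b ∸ a)) (m≤n⇒m∸n≡0 a≤b)

absDiff≤ : ∀ {a b c} → a ≤ c → b ≤ c → absDiff a b ≤ c
absDiff≤ {a} {b} a≤c b≤c with ≤-total a b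
... | inj₁ a≤b = ≤-trans (≤-reflexive (absDiff≡∸ a≤b)) (≤-trans (m∸n≤m b a) b≤c)
... | inj₂ b≤a = ≤-trans (≤-reflexive (trans (absDiff-comm a b) (absDiff≡∸ b≤a))) (≤-trans (m∸n≤m a b) a≤c)

module _ {d : ℕ} .{{_ : NonZero d}} where

  ∣∸⇒%≡ : ∀ {a b} → a ≤ b → d ∣ b ∸ a → a % d ≡ b % d
  ∣∸⇒%≡ {a} {b} a≤b (divides q b∸a≡qd) = begin
    a % d             ≡⟨ [m+kn]%n≡m%n a q d ⟨
    (a + q * d) % d   ≡⟨ cong (λ x → (a + x) % d) b∸a≡qd ⟨
    (a + (b ∸ a)) % d ≡⟨ cong (_% d) (m+[n∸m]≡n a≤b) ⟩
    b % d             ∎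
    where open ≡-Reasoning

  ∣absDiff⇒%≡ : ∀ a b → d ∣ absDiff a b → a % d ≡ b % d
  ∣absDiff⇒%≡ a b d∣ab with ≤-total a b
  ... | inj₁ a≤b = ∣∸⇒%≡ a≤b (subst (d ∣_) (absDiff≡∸ a≤b) d∣ab)
  ... | inj₂ b≤a = sym (∣∸⇒%≡ b≤a (subst (d ∣_) (trans (absDiff-comm a b) (absDiff≡∸ b≤a)) d∣ab))

  length≤-residue-class : ∀ {k r} {ns : List ℕ} → Unique ns →
    All (λ x → x % d ≡ r) ns → All (_< k * d) ns → length ns ≤ k
  length≤-residue-class {ns = ns} u ≡r <kd =
    length≤-pigeonhole (_/ d) u /-injective (All.map m<n*o⇒m/o<n <kd)
    where
    open ≡-Reasoning
    /-injective : ∀ {x y} → x ∈ ns → y ∈ ns → x / d ≡ y / d → x ≡ y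
    /-injective {x} {y} x∈ns y∈ns /≡ = begin
      x                 ≡⟨ m≡m%n+[m/n]*n x d ⟩
      x % d + x / d * d ≡⟨ cong₂ (λ r q → r + q * d) (trans (All.lookup ≡r x∈ns) (sym (All.lookup ≡r y∈ns))) /≡ ⟩
      y % d + y / d * d ≡⟨ m≡m%n+[m/n]*n y d ⟨
      y                 ∎

odd-cofactor : ∀ {d n} → d ∣ n + n → ¬ d ∣ n → ∃[ j ] n + n ≡ suc (2 * j) * d
odd-cofactor {d} {n} (divides k n+n≡kd) d∤n with k % 2 | m≡m%n+[m/n]*n k 2 | m%n<n k 2
... | 0 | k≡2[k/2] | _ = contradiction (divides (k / 2) (*-cancelˡ-≡ n (k / 2 * d) 2 2n≡2[k/2]d)) d∤n
  where
  open ≡-Reasoning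
  2n≡2[k/2]d : 2 * n ≡ 2 * (k / 2 * d)
  2n≡2[k/2]d = begin
    2 * n           ≡⟨ cong (n +_) (+-identityʳ n) ⟩
    n + n           ≡⟨ n+n≡kd ⟩
    k * d           ≡⟨ cong (_* d) (trans k≡2[k/2] (*-comm (k / 2) 2)) ⟩
    2 * (k / 2) * d ≡⟨ *-assoc 2 (k / 2) d ⟩
    2 * (k / 2 * d) ∎
... | 1 | k≡1+2[k/2] | _ =
  k / 2 , trans n+n≡kd (cong (_* d) (trans k≡1+2[k/2] (cong suc (*-comm (k / 2) 2))))
... | suc (suc _) | _ | s≤s (s≤s ())

endpoints-⊆ : ∀ {v} {F G : List (Edge v)} → F ⊆ G → endpoints F ⊆ endpoints G
endpoints-⊆ [] = []
endpoints-⊆ (e ∷ʳ F⊆G) = proj₁ e ∷ʳ proj₂ e ∷ʳ endpoints-⊆ F⊆G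
endpoints-⊆ (refl ∷ F⊆G) = refl ∷ refl ∷ endpoints-⊆ F⊆G

length-endpoints : ∀ {v} (F : List (Edge v)) → length (endpoints F) ≡ 2 * length F
length-endpoints [] = refl
length-endpoints (_ ∷ F) = trans (cong (2 +_) (length-endpoints F)) (sym (*-suc 2 (length F)))

-- Modulo a divisor of v, the two candidates |u - w| and v - |u - w| for the length agree up to sign.
∣edgeLength⇒∣absDiff : ∀ {v d} → d ∣ v → (u w : Fin v) →
  d ∣ edgeLength v (u , w) → d ∣ absDiff (toℕ u) (toℕ w)
∣edgeLength⇒∣absDiff {v} {d} d∣v u w d∣ℓ
  with ⊓-sel (absDiff (toℕ u) (toℕ w)) (v ∸ absDiff (toℕ u) (toℕ w))
... | inj₁ ℓ≡δ = subst (d ∣_) ℓ≡δ d∣ℓ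
... | inj₂ ℓ≡v∸δ = ∣m+n∣m⇒∣n (subst (d ∣_) (sym (m∸n+n≡m δ≤v)) d∣v) (subst (d ∣_) ℓ≡v∸δ d∣ℓ)
  where
  δ≤v : absDiff (toℕ u) (toℕ w) ≤ v
  δ≤v = absDiff≤ (<⇒≤ (toℕ<n u)) (<⇒≤ (toℕ<n w))

module _ {v d : ℕ} .{{_ : NonZero d}} where

  residue : Edge v → ℕ
  residue (u , _) = toℕ u % d

  endpoints-in-class : ∀ {r} {H : List (Edge v)} → d ∣ v →
    All (λ e → d ∣ edgeLength v e × residue e ≡ r) H → All (λ x → toℕ x % d ≡ r) (endpoints H)
  endpoints-in-class _ [] = []
  endpoints-in-class {H = (u , w) ∷ _} d∣v ((d∣ℓ , u≡r) ∷ rest) =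
    u≡r ∷ trans (sym (∣absDiff⇒%≡ _ _ (∣edgeLength⇒∣absDiff d∣v u w d∣ℓ))) u≡r ∷ endpoints-in-class d∣v rest

  length≤-class : ∀ {j r} → v ≡ suc (2 * j) * d → (H : List (Edge v)) → Unique (endpoints H) →
    All (λ e → d ∣ edgeLength v e × residue e ≡ r) H → length H ≤ j
  length≤-class {j} v≡[1+2j]d H unique inClass = s≤s⁻¹ (*-cancelˡ-< 2 (length H) (suc j) (begin-strict
    2 * length H                    ≡⟨ length-endpoints H ⟨
    length (endpoints H)            ≡⟨ length-map toℕ (endpoints H) ⟨
    length (map toℕ (endpoints H))  ≤⟨ length≤-residue-class (Unique.map⁺ toℕ-injective unique)
                                         (All.map⁺ (endpoints-in-class d∣v inClass)) (All.map⁺ below-v) ⟩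
    suc (2 * j)                     <⟨ n<1+n _ ⟩
    2 + 2 * j                       ≡⟨ *-suc 2 j ⟨
    2 * suc j                       ∎))
    where
    open ≤-Reasoning
    d∣v : d ∣ v
    d∣v = divides (suc (2 * j)) v≡[1+2j]d
    below-v : All (λ x → toℕ x < suc (2 * j) * d) (endpoints H)
    below-v = All.tabulate λ {x} _ → subst (toℕ x <_) v≡[1+2j]d (toℕ<n x)

  length-filter-∣edgeLength≤ : ∀ {j} → v ≡ suc (2 * j) * d →
    (F : List (Edge v)) → Unique (endpoints F) → length (filter ((d ∣?_) ∘ edgeLength v) F) ≤ d * j
  length-filter-∣edgeLength≤ {j} v≡[1+2j]d F unique =
    length≤*-fibres residue d j good (All.tabulate λ {e} _ → m%n<n (toℕ (proj₁ e)) d) fibre≤j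
    where
    good : List (Edge v)
    good = filter ((d ∣?_) ∘ edgeLength v) F
    fibre≤j : ∀ r → length (filter (λ e → residue e ≟ r) good) ≤ j
    fibre≤j r = length≤-class v≡[1+2j]d _
      (Unique-resp-⊆ (endpoints-⊆ (⊆-trans (filter-⊆ _ good) (filter-⊆ _ F))) unique)
      (All.zip (All.filter⁺ _ (All.all-filter _ F) , All.all-filter _ good))

proposition2p3 : (n : ℕ) → 0 < n → (L : List ℕ) → length L ≡ n → All (λ x → 0 < x × x ≤ n) L →
    Σ (List (Edge (n + n))) (λ F → IsPerfectMatching n F × lengths F ↭ L) →
    (d : ℕ) → d ∣ (n + n) → ¬ (d ∣ n) →
    2 * countMultiples d L ≤ (n + n) ∸ d
proposition2p3 n 0<n _ _ _ _ zero 0∣n+n _ = contradiction (m+n≡0⇒m≡0 n (0∣⇒≡0 0∣n+n)) (m<n⇒n≢0 0<n)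
proposition2p3 n _ L _ _ (F , (_ , unique) , lengthsF↭L) d@(suc _) d∣n+n d∤n = begin
  2 * countMultiples d L                           ≡⟨ cong (2 *_) countMultiples≡ ⟩
  2 * length (filter ((d ∣?_) ∘ edgeLength v) F)   ≤⟨ *-monoʳ-≤ 2 good≤dj ⟩
  2 * (d * j)                                      ≡⟨ 2[dj]≡v∸d ⟩
  v ∸ d                                            ∎
  where
  open ≤-Reasoning
  v : ℕ
  v = n + n
  j : ℕ
  j = proj₁ (odd-cofactor d∣n+n d∤n)
  v≡[1+2j]d : v ≡ suc (2 * j) * d
  v≡[1+2j]d = proj₂ (odd-cofactor d∣n+n d∤n)
  good≤dj : length (filter ((d ∣?_) ∘ edgeLength v) F) ≤ d * j
  good≤dj = length-filter-∣edgeLength≤ {j = j} v≡[1+2j]d F unique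
  countMultiples≡ : countMultiples d L ≡ length (filter ((d ∣?_) ∘ edgeLength v) F)
  countMultiples≡ = trans (↭-length (filter-↭ (d ∣?_) (↭-sym lengthsF↭L)))
                          (length-filter-map (d ∣?_) (edgeLength v) F)
  2[dj]≡v∸d : 2 * (d * j) ≡ v ∸ d
  2[dj]≡v∸d = ≡.begin
    2 * (d * j)         ≡.≡⟨ cong (2 *_) (*-comm d j) ⟩
    2 * (j * d)         ≡.≡⟨ *-assoc 2 j d ⟨
    2 * j * d           ≡.≡⟨ m+n∸m≡n d (2 * j * d) ⟨
    suc (2 * j) * d ∸ d ≡.≡⟨ cong (_∸ d) v≡[1+2j]d ⟨
    v ∸ d               ≡.∎
    where module ≡ = ≡-Reasoning
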